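{- Let $K=\mathbb{Q}(\sqrt{73})$, $\omega=\frac{1+\sqrt{73}}{2}$, $\mathcal{O}_K=\mathbb{Z}[\omega]$, and let $\rho=4+\omega$, $\rho'=5-\omega$, $\sigma=83+22\omega$, $\sigma'=105-22\omega$. Let $$\gamma\in\{\rho,\rho',\sigma,\sigma',\rho\sigma,\rho\sigma',\rho'\sigma,\rho'\sigma',\rho^2\sigma,\rho'^2\sigma',\rho\sigma'^2,\rho'\sigma^2,2\rho,2\rho',2\sigma,2\sigma',2\rho\sigma,2\rho'\sigma',3\rho,3\rho'\}.$$ If $\alpha\in\mathcal{O}_K$ and $\beta\in\mathcal{O}_K$ is totally positive with $\gamma=\alpha^2+\beta$, then $\alpha=0$.
   Context: An element of $K\subset\mathbb{R}$ is totally positive if it and its Galois conjugate (under $\sqrt{73}\mapsto-\sqrt{73}$) are both positive. -}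

module Defs where

open import Data.Integer using (ℤ; +_; -_; _+_; _*_; _<_; _≤_)
open import Data.Product using (_×_)
open import Data.Sum using (_⊎_)
open import Data.List using (List; _∷_; [])

-- An element a + b·ω of O_K = ℤ[ω], ω = (1 + √73)/2, so ω² = ω + 18.
record OK : Set where
  constructor _+_ω
  field
    re : ℤ
    om : ℤ
open OK public

infixl 6 _⊕_
infixl 7 _⊗_

_⊕_ : OK → OK → OK
(a + b ω) ⊕ (c + d ω) = (a + c) + (b + d) ω

_⊗_ : OK → OK → OK
(a + b ω) ⊗ (c + d ω) = (a * c + + 18 * (b * d)) + (a * d + b * c + b * d) ω

fromℤ : ℤ → OK
fromℤ n = n + (+ 0) ω

0K : OK
0K = fromℤ (+ 0)

-- The real number x + y·√73 is positive (decided in integer arithmetic).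
Pos√73 : ℤ → ℤ → Set
Pos√73 x y =
    (+ 0 < x × + 0 ≤ y)
  ⊎ (+ 0 < x × y < + 0 × + 73 * (y * y) < x * x)
  ⊎ (+ 0 < y × x ≤ + 0 × x * x < + 73 * (y * y))

-- a + bω = ((2a + b) + b√73)/2 ; its conjugate is ((2a + b) − b√73)/2.
TotallyPositive : OK → Set
TotallyPositive (a + b ω) =
  Pos√73 (+ 2 * a + b) b × Pos√73 (+ 2 * a + b) (- b)

ρ ρ' σ σ' : OK
ρ  = (+ 4) + (+ 1) ω
ρ' = (+ 5) + (- (+ 1)) ω
σ  = (+ 83) + (+ 22) ω
σ' = (+ 105) + (- (+ 22)) ω

two three : OK
two = fromℤ (+ 2)
three = fromℤ (+ 3)

gammas : List OK
gammas =
  ρ ∷ ρ' ∷ σ ∷ σ' ∷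
  ρ ⊗ σ ∷ ρ ⊗ σ' ∷ ρ' ⊗ σ ∷ ρ' ⊗ σ' ∷
  ρ ⊗ ρ ⊗ σ ∷ ρ' ⊗ ρ' ⊗ σ' ∷ ρ ⊗ σ' ⊗ σ' ∷ ρ' ⊗ σ ⊗ σ ∷
  two ⊗ ρ ∷ two ⊗ ρ' ∷ two ⊗ σ ∷ two ⊗ σ' ∷
  two ⊗ ρ ⊗ σ ∷ two ⊗ ρ' ⊗ σ' ∷ three ⊗ ρ ∷ three ⊗ ρ' ∷ []

{-# OPTIONS --safe #-}
-- If γ = α² + β with β totally positive, then tr β > 0, so for α = a + bω
-- tr (α²) = a² + (a + b)² + 36 b² < tr γ: only finitely many α are possible.
-- For each of them one checks that γ − α² has non-positive trace or norm unless α = 0.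
module Submission where

open import Defs
open import Relation.Binary.PropositionalEquality
  using (_≡_; refl; sym; trans; cong; cong₂; subst; module ≡-Reasoning)
open import Data.List.Membership.Propositional using (_∈_)

open import Data.Integer
  using (ℤ; +_; +[1+_]; -[1+_]; -_; _+_; _-_; _*_; _<_; _≤_; ∣_∣; +<+; _<?_; _≤?_; _≟_)
import Data.Integer.Properties as ℤ
open import Data.Integer.Tactic.RingSolver using (solve-∀)
open import Data.Nat as ℕ using (ℕ; suc)
import Data.Nat.Properties as ℕ
open import Data.List using (List; applyUpTo; _++_)
open import Data.List.Membership.Propositional.Properties using (∈-applyUpTo⁺; ∈-++⁺ˡ; ∈-++⁺ʳ)
open import Data.List.Relation.Unary.All using (All; []; _∷_; all?; lookup)
open import Data.Product using (_×_; _,_; uncurry)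
open import Data.Sum using (inj₁; inj₂)
open import Data.Empty using (⊥-elim)
open import Relation.Nullary using (Dec; yes; no)
open import Relation.Nullary.Decidable using (True; toWitness; _×-dec_; _→-dec_)

tr : OK → ℤ
tr (a + b ω) = + 2 * a + b

infixl 6 _⊖_

_⊖_ : OK → OK → OK
(a + b ω) ⊖ (c + d ω) = (a - c) + (b - d) ω

⊕-⊖-cancelˡ : ∀ α β → β ≡ (α ⊕ β) ⊖ α
⊕-⊖-cancelˡ (a + b ω) (c + d ω) = cong₂ _+_ω (cancel a c) (cancel b d)
  where
  cancel : ∀ x y → y ≡ (x + y) - x
  cancel = solve-∀

tr-⊖ : ∀ γ α → tr (γ ⊖ α) ≡ tr γ - tr α
tr-⊖ (a + b ω) (c + d ω) = lemma a b c d
  where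
  lemma : ∀ a b c d → + 2 * (a - c) + (b - d) ≡ (+ 2 * a + b) - (+ 2 * c + d)
  lemma = solve-∀

Q : OK → ℕ
Q (a + b ω) = ∣ a ∣ ℕ.* ∣ a ∣ ℕ.+ ∣ a + b ∣ ℕ.* ∣ a + b ∣ ℕ.+ 36 ℕ.* (∣ b ∣ ℕ.* ∣ b ∣)

i*i≡+∣i∣*∣i∣ : ∀ i → i * i ≡ + (∣ i ∣ ℕ.* ∣ i ∣)
i*i≡+∣i∣*∣i∣ (+ n)    = sym (ℤ.pos-* n n)
i*i≡+∣i∣*∣i∣ -[1+ n ] = refl

tr-square : ∀ α → tr (α ⊗ α) ≡ + Q α
tr-square (a + b ω) = begin
  tr ((a + b ω) ⊗ (a + b ω))                  ≡⟨ expand a b ⟩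
  a * a + (a + b) * (a + b) + + 36 * (b * b)  ≡⟨ cong₂ _+_ (cong₂ _+_ (square a) (square (a + b)))
                                                         (trans (cong (+ 36 *_) (square b)) (sym (ℤ.pos-* 36 (∣ b ∣ ℕ.* ∣ b ∣)))) ⟩
  + Q (a + b ω)                               ∎
  where
  open ≡-Reasoning
  square = i*i≡+∣i∣*∣i∣
  expand : ∀ a b → + 2 * (a * a + + 18 * (b * b)) + (a * b + b * a + b * b)
                 ≡ a * a + (a + b) * (a + b) + + 36 * (b * b)
  expand = solve-∀

∣re∣²≤Q : ∀ α → ∣ re α ∣ ℕ.* ∣ re α ∣ ℕ.≤ Q α
∣re∣²≤Q (a + b ω) = ℕ.≤-trans (ℕ.m≤m+n _ _) (ℕ.m≤m+n _ _)

36∣om∣²≤Q : ∀ α → 36 ℕ.* (∣ om α ∣ ℕ.* ∣ om α ∣) ℕ.≤ Q α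
36∣om∣²≤Q (a + b ω) = ℕ.m≤n+m _ (∣ a ∣ ℕ.* ∣ a ∣ ℕ.+ ∣ a + b ∣ ℕ.* ∣ a + b ∣)

0<i-j⇒j<i : ∀ {i j} → + 0 < i - j → j < i
0<i-j⇒j<i {i} {j} 0<i-j = begin-strict
  j            ≡⟨ ℤ.+-identityˡ j ⟨
  + 0 + j      <⟨ ℤ.+-monoˡ-< j 0<i-j ⟩
  i - j + j    ≡⟨ simplify i j ⟩
  i            ∎
  where
  open ℤ.≤-Reasoning
  simplify : ∀ i j → i - j + j ≡ i
  simplify = solve-∀

-- (tr β)² − 73 (om β)² is 4 N(β).
PositiveTraceAndNorm : OK → Set
PositiveTraceAndNorm β = + 0 < tr β × + 73 * (om β * om β) < tr β * tr β

positiveTraceAndNorm? : ∀ β → Dec (PositiveTraceAndNorm β)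
positiveTraceAndNorm? β = (+ 0 <? tr β) ×-dec (+ 73 * (om β * om β) <? tr β * tr β)

Pos√73-conjugates⇒ : ∀ x y → Pos√73 x y → Pos√73 x (- y) → + 0 < x × + 73 * (y * y) < x * x
Pos√73-conjugates⇒ x y (inj₂ (inj₁ (0<x , _ , 73y²<x²))) _ = 0<x , 73y²<x²
Pos√73-conjugates⇒ x y (inj₁ (0<x , _)) (inj₂ (inj₁ (_ , _ , 73y²<x²))) =
  0<x , subst (λ t → + 73 * t < x * x) (neg*neg y) 73y²<x²
  where
  neg*neg : ∀ y → - y * - y ≡ y * y
  neg*neg = solve-∀
Pos√73-conjugates⇒ +[1+ n ] (+ 0) (inj₁ (0<x , _)) (inj₁ _) = 0<x , +<+ (ℕ.s≤s ℕ.z≤n)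
Pos√73-conjugates⇒ (+ 0) (+ 0) (inj₁ (0<0 , _)) (inj₁ _) = ⊥-elim (ℤ.<-irrefl refl 0<0)
Pos√73-conjugates⇒ x +[1+ n ] (inj₁ _) (inj₁ (_ , ()))
Pos√73-conjugates⇒ x -[1+ n ] (inj₁ (_ , ())) (inj₁ _)
Pos√73-conjugates⇒ x y (inj₁ (0<x , _)) (inj₂ (inj₂ (_ , x≤0 , _))) = ⊥-elim (ℤ.<⇒≱ 0<x x≤0)
Pos√73-conjugates⇒ x y (inj₂ (inj₂ (_ , x≤0 , _))) (inj₁ (0<x , _)) = ⊥-elim (ℤ.<⇒≱ 0<x x≤0)
Pos√73-conjugates⇒ x y (inj₂ (inj₂ (_ , x≤0 , _))) (inj₂ (inj₁ (0<x , _))) = ⊥-elim (ℤ.<⇒≱ 0<x x≤0)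
Pos√73-conjugates⇒ x y (inj₂ (inj₂ (0<y , _))) (inj₂ (inj₂ (0<-y , _))) =
  ⊥-elim (ℤ.<-asym 0<y (ℤ.neg-cancel-< 0<-y))

totallyPositive⇒positiveTraceAndNorm : ∀ β → TotallyPositive β → PositiveTraceAndNorm β
totallyPositive⇒positiveTraceAndNorm (c + d ω) = uncurry (Pos√73-conjugates⇒ (+ 2 * c + d) d)

Fits : OK → OK → Set
Fits γ α = PositiveTraceAndNorm (γ ⊖ α ⊗ α)

fits? : ∀ γ α → Dec (Fits γ α)
fits? γ α = positiveTraceAndNorm? (γ ⊖ α ⊗ α)

Q<tr : ∀ γ α → Fits γ α → + Q α < tr γ
Q<tr γ α (0<tr , _) = 0<i-j⇒j<i (subst (+ 0 <_) tr[γ-α²]≡trγ-Q 0<tr)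
  where
  tr[γ-α²]≡trγ-Q : tr (γ ⊖ α ⊗ α) ≡ tr γ - + Q α
  tr[γ-α²]≡trγ-Q = trans (tr-⊖ γ (α ⊗ α)) (cong (λ t → tr γ - t) (tr-square α))

square-cancel-< : ∀ {m n} → m ℕ.* m ℕ.< n ℕ.* n → m ℕ.< n
square-cancel-< {m} {n} m²<n² with m ℕ.<? n
... | yes m<n = m<n
... | no m≮n  = ⊥-elim (ℕ.<⇒≱ m²<n² (ℕ.*-mono-≤ n≤m n≤m))
  where n≤m = ℕ.≮⇒≥ m≮n

range : ℕ → List ℤ
range n = applyUpTo +_ (suc n) ++ applyUpTo (λ k → - + k) (suc n)

∈-range : ∀ {n} i → ∣ i ∣ ℕ.≤ n → i ∈ range n
∈-range {n} (+ k)    k≤n = ∈-++⁺ˡ (∈-applyUpTo⁺ +_ (ℕ.s≤s k≤n))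
∈-range {n} -[1+ k ] k<n = ∈-++⁺ʳ (applyUpTo +_ (suc n)) (∈-applyUpTo⁺ (λ k → - + k) (ℕ.s≤s k<n))

-- As tr (α²) ≥ a² and tr (α²) ≥ 36 b², these bound the coordinates of every α that fits under γ.
TraceBounds : OK → ℕ → ℕ → Set
TraceBounds γ A B = tr γ ≤ + (suc A ℕ.* suc A) × tr γ ≤ + (36 ℕ.* (suc B ℕ.* suc B))

traceBounds? : ∀ γ A B → Dec (TraceBounds γ A B)
traceBounds? γ A B = (tr γ ≤? + (suc A ℕ.* suc A)) ×-dec (tr γ ≤? + (36 ℕ.* (suc B ℕ.* suc B)))

OnlyZeroFitsIn : OK → ℕ → ℕ → Set
OnlyZeroFitsIn γ A B =
  All (λ a → All (λ b → Fits γ (a + b ω) → a ≡ + 0 × b ≡ + 0) (range B)) (range A)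

onlyZeroFitsIn? : ∀ γ A B → Dec (OnlyZeroFitsIn γ A B)
onlyZeroFitsIn? γ A B =
  all? (λ a → all? (λ b → fits? γ (a + b ω) →-dec ((a ≟ + 0) ×-dec (b ≟ + 0))) (range B)) (range A)

NoNonzeroSquareSummand : OK → Set
NoNonzeroSquareSummand γ = (α β : OK) → TotallyPositive β → γ ≡ α ⊗ α ⊕ β → α ≡ 0K

noNonzeroSquareSummand : ∀ γ A B → TraceBounds γ A B → OnlyZeroFitsIn γ A B →
                         NoNonzeroSquareSummand γ
noNonzeroSquareSummand γ A B (trγ≤A , trγ≤B) onlyZero α@(a + b ω) β β≫0 γ≡α²+β =
  uncurry (cong₂ _+_ω) a≡0×b≡0
  where
  fits : Fits γ α
  fits = subst PositiveTraceAndNorm β≡γ-α² (totallyPositive⇒positiveTraceAndNorm β β≫0)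
    where
    β≡γ-α² : β ≡ γ ⊖ α ⊗ α
    β≡γ-α² = trans (⊕-⊖-cancelˡ (α ⊗ α) β) (cong (_⊖ α ⊗ α) (sym γ≡α²+β))

  Q<bound : ∀ {k} → tr γ ≤ + k → Q α ℕ.< k
  Q<bound trγ≤k = ℤ.drop‿+<+ (ℤ.<-≤-trans (Q<tr γ α fits) trγ≤k)

  ∣a∣≤A : ∣ a ∣ ℕ.≤ A
  ∣a∣≤A = ℕ.≤-pred (square-cancel-< (ℕ.≤-<-trans (∣re∣²≤Q α) (Q<bound trγ≤A)))

  ∣b∣≤B : ∣ b ∣ ℕ.≤ B
  ∣b∣≤B = ℕ.≤-pred (square-cancel-< (ℕ.*-cancelˡ-< 36 _ _ (ℕ.≤-<-trans (36∣om∣²≤Q α) (Q<bound trγ≤B))))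

  a≡0×b≡0 : a ≡ + 0 × b ≡ + 0
  a≡0×b≡0 = lookup (lookup onlyZero (∈-range a ∣a∣≤A)) (∈-range b ∣b∣≤B) fits

byEnumeration : ∀ γ A B → {True (traceBounds? γ A B ×-dec onlyZeroFitsIn? γ A B)} →
                NoNonzeroSquareSummand γ
byEnumeration γ A B {checked} = uncurry (noNonzeroSquareSummand γ A B) (toWitness checked)

-- Each A, B is the least value making TraceBounds hold.
certificates : All NoNonzeroSquareSummand gammas
certificates =
    byEnumeration _ 2 0 ∷ byEnumeration _ 2 0 ∷ byEnumeration _ 13 2 ∷ byEnumeration _ 13 2
  ∷ byEnumeration _ 40 6 ∷ byEnumeration _ 6 1 ∷ byEnumeration _ 6 1 ∷ byEnumeration _ 40 6
  ∷ byEnumeration _ 120 20 ∷ byEnumeration _ 120 20 ∷ byEnumeration _ 89 14 ∷ byEnumeration _ 89 14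
  ∷ byEnumeration _ 4 0 ∷ byEnumeration _ 4 0 ∷ byEnumeration _ 19 3 ∷ byEnumeration _ 19 3
  ∷ byEnumeration _ 57 9 ∷ byEnumeration _ 57 9 ∷ byEnumeration _ 5 0 ∷ byEnumeration _ 5 0 ∷ []

lemma5p1 : (γ : OK) → γ ∈ gammas → (α β : OK) → TotallyPositive β →
    γ ≡ α ⊗ α ⊕ β → α ≡ 0K
lemma5p1 γ = lookup certificates
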